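{- The set $\mathrm{Sort}(\mathfrak{s}_{1\underline{32}})=\bigcup_{n\ge1}\mathrm{Sort}_n(\mathfrak{s}_{1\underline{32}})$ is not a permutation class: $2413\in\mathrm{Sort}(\mathfrak{s}_{1\underline{32}})$ contains $132$, but $132\notin\mathrm{Sort}(\mathfrak{s}_{1\underline{32}})$.
   Context: A permutation class is a set of permutations closed under (classical) pattern containment. A pattern is a permutation $\sigma$ in which some blocks of consecutive entries may be underlined; a sequence contains it if it has a subsequence order-isomorphic to $\sigma$ whose entries corresponding to a common underlined block are adjacent in the sequence. Pattern-avoiding stack map $\mathfrak{s}_\sigma$: process input $\tau_1,\dots,\tau_n$ in order; when $\tau_i$ is next, while the stack is nonempty and the sequence formed by placing $\tau_i$ on top of the stack, read top to bottom, contains $\sigma$ (underlined entries adjacent in the stack), pop the top entry to the output; then push $\tau_i$; at the end pop all remaining entries top to bottom to the output. $\mathrm{Sort}_n(\mathfrak{s}_\sigma)$ is the set of $\tau\in\mathfrak S_n$ such that $\mathfrak{s}_\sigma(\tau)$ avoids $231$. -}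

module Defs where

open import Data.Nat using (ℕ; zero; suc; _≤_; _<ᵇ_; _≡ᵇ_)
open import Data.Bool using (Bool; true; false; T; if_then_else_; _∧_)
open import Data.List using (List; []; _∷_; _++_; map; concat; concatMap; length; take; drop; tails; upTo; zip)
open import Data.Bool.ListAction using (any; all)
open import Data.List.Relation.Binary.Permutation.Propositional using (_↭_)
open import Data.Product using (_×_; _,_; Σ; proj₁; proj₂)
open import Relation.Nullary using (¬_)

IsPerm : ℕ → List ℕ → Set
IsPerm n τ = τ ↭ map suc (upTo n)

-- A pattern with underlined blocks: a list of blocks of consecutive entries.
-- The entries of one block must be adjacent in the sequence.
-- E.g. 1 \underline{32} is  (1 ∷ []) ∷ (3 ∷ 2 ∷ []) ∷ [].
Pattern : Set
Pattern = List (List ℕ)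

classical : List ℕ → Pattern
classical = map (λ x → x ∷ [])

-- All subsequences of w made of consecutive factors of the given lengths,
-- appearing left to right (positions of different blocks strictly increasing).
blockSubseqs : {A : Set} → List ℕ → List A → List (List A)
blockSubseqs [] w = [] ∷ []
blockSubseqs (l ∷ ls) w =
  concatMap (λ s → if l Data.Nat.≤ᵇ length s
                   then map (take l s ++_) (blockSubseqs ls (drop l s))
                   else [])
            (tails w)

orderIso : List ℕ → List ℕ → Bool
orderIso u v =
  (length u ≡ᵇ length v) ∧
  all (λ p → all (λ q → eqB (proj₁ p <ᵇ proj₁ q) (proj₂ p <ᵇ proj₂ q)) (zip u v)) (zip u v)
  where
  eqB : Bool → Bool → Bool
  eqB true true = true
  eqB false false = true
  eqB _ _ = false

containsᵇ : Pattern → List ℕ → Bool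
containsᵇ p w = any (orderIso (concat p)) (blockSubseqs (map length p) w)

Contains : List ℕ → Pattern → Set
Contains w p = T (containsᵇ p w)

ContainsPerm : List ℕ → List ℕ → Set
ContainsPerm w σ = Contains w (classical σ)

Avoids : List ℕ → List ℕ → Set
Avoids w σ = ¬ ContainsPerm w σ

-- Stack is a list, head = top.  popWhile σ x st: pop while the stack is
-- nonempty and x placed on top of the stack (read top to bottom) contains σ.
-- Returns (remaining stack, popped entries in output order).
popWhile : Pattern → ℕ → List ℕ → List ℕ × List ℕ
popWhile σ x [] = [] , []
popWhile σ x (y ∷ ys) with containsᵇ σ (x ∷ y ∷ ys)
... | true  = let r = popWhile σ x ys in proj₁ r , y ∷ proj₂ r
... | false = y ∷ ys , []

stackRun : Pattern → List ℕ → List ℕ → List ℕ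
stackRun σ [] st = st
stackRun σ (x ∷ xs) st =
  let r = popWhile σ x st in proj₂ r ++ stackRun σ xs (x ∷ proj₁ r)

stackMap : Pattern → List ℕ → List ℕ
stackMap σ τ = stackRun σ τ []

InSort : Pattern → List ℕ → Set
InSort σ τ = Σ ℕ (λ n → (1 ≤ n) × IsPerm n τ × Avoids (stackMap σ τ) (2 ∷ 3 ∷ 1 ∷ []))

IsPermClass : (List ℕ → Set) → Set
IsPermClass C = ∀ (τ π : List ℕ) (m : ℕ) → C τ → 1 ≤ m → IsPerm m π → ContainsPerm τ π → C π

p1-32 : Pattern
p1-32 = (1 ∷ []) ∷ (3 ∷ 2 ∷ []) ∷ []

{-# OPTIONS --safe #-}
module Submission where

-- On 2413 the map pops 4 when 1 arrives (1 4 2 contains 1\underline{32}) and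
-- outputs 4312, which avoids 231.  On 132 nothing is ever popped, so the stack
-- simply reverses the input and outputs 231.  Hence 132 is a pattern of a
-- sortable permutation without being sortable itself.

open import Defs
open import Data.List using (List; []; _∷_)
open import Data.Nat using (ℕ; _≤_; s≤s; z≤n)
open import Data.Product using (_×_; _,_)
open import Relation.Nullary using (¬_)
open import Relation.Binary.PropositionalEquality using (_≡_; refl)
open import Data.List.Relation.Binary.Permutation.Propositional using (refl; prep; swap; trans)

¬isPermClass : ∀ {C : List ℕ → Set} τ π m →
               C τ → 1 ≤ m → IsPerm m π → ContainsPerm τ π → ¬ C π →
               ¬ IsPermClass C
¬isPermClass τ π m τ∈C 1≤m π-perm τ⊇π π∉C closed =
  π∉C (closed τ π m τ∈C 1≤m π-perm τ⊇π)

isPerm-2413 : IsPerm 4 (2 ∷ 4 ∷ 1 ∷ 3 ∷ [])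
isPerm-2413 =
  trans (prep 2 (swap 4 1 refl))
        (trans (swap 2 1 refl) (prep 1 (prep 2 (swap 4 3 refl))))

isPerm-132 : IsPerm 3 (1 ∷ 3 ∷ 2 ∷ [])
isPerm-132 = prep 1 (swap 3 2 refl)

stackMap-2413 : stackMap p1-32 (2 ∷ 4 ∷ 1 ∷ 3 ∷ []) ≡ 4 ∷ 3 ∷ 1 ∷ 2 ∷ []
stackMap-2413 = refl

stackMap-132 : stackMap p1-32 (1 ∷ 3 ∷ 2 ∷ []) ≡ 2 ∷ 3 ∷ 1 ∷ []
stackMap-132 = refl

avoids-4312-231 : Avoids (4 ∷ 3 ∷ 1 ∷ 2 ∷ []) (2 ∷ 3 ∷ 1 ∷ [])
avoids-4312-231 ()

contains-231-231 : ContainsPerm (2 ∷ 3 ∷ 1 ∷ []) (2 ∷ 3 ∷ 1 ∷ [])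
contains-231-231 = _

-- witnessed by the subsequence 2 4 3
contains-2413-132 : ContainsPerm (2 ∷ 4 ∷ 1 ∷ 3 ∷ []) (1 ∷ 3 ∷ 2 ∷ [])
contains-2413-132 = _

inSort-2413 : InSort p1-32 (2 ∷ 4 ∷ 1 ∷ 3 ∷ [])
inSort-2413 rewrite stackMap-2413 = 4 , s≤s z≤n , isPerm-2413 , avoids-4312-231

¬inSort-132 : ¬ InSort p1-32 (1 ∷ 3 ∷ 2 ∷ [])
¬inSort-132 rewrite stackMap-132 = λ (_ , _ , _ , avoids) → avoids contains-231-231

mainTheorem13 : InSort p1-32 (2 ∷ 4 ∷ 1 ∷ 3 ∷ [])
                × ContainsPerm (2 ∷ 4 ∷ 1 ∷ 3 ∷ []) (1 ∷ 3 ∷ 2 ∷ [])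
                × ¬ InSort p1-32 (1 ∷ 3 ∷ 2 ∷ [])
                × ¬ IsPermClass (InSort p1-32)
mainTheorem13 =
  inSort-2413 , contains-2413-132 , ¬inSort-132 ,
  ¬isPermClass _ _ 3 inSort-2413 (s≤s z≤n) isPerm-132 contains-2413-132 ¬inSort-132
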